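{- Let $d\geq 2$. Suppose a bipartite graph $G$ with vertex classes $A$ and $B$ satisfies: $|A|\geq d^6|B|$; $d(x,y)\leq d$ for all distinct $x,y\in B$; and $d_G(v)\leq d$ for every $v\in A$. Then $G$ contains a subgraph $G'$ which is $C_4$-free and has average degree at least $d(G)/5$.
   Context: $d(G)=2e(G)/|V(G)|$ is the average degree, $d_G(v)$ is the degree of $v$, and the codegree $d(x,y)$ is the number of common neighbours of $x$ and $y$ in $G$. A graph is $C_4$-free if it contains no cycle of length $4$. -}

module Defs where

open import Data.Bool using (Bool; true; false; if_then_else_; _∧_)
open import Data.Nat using (ℕ; zero; suc; _+_; _*_; _^_; _≤_)
open import Data.Fin using (Fin; zero; suc)
open import Data.Product using (Σ; _×_; ∃)
open import Relation.Binary.PropositionalEquality using (_≡_)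
open import Relation.Nullary using (¬_)

count : ∀ {n} → (Fin n → Bool) → ℕ
count {zero}  f = 0
count {suc n} f = (if f zero then 1 else 0) + count (λ i → f (suc i))

-- A (finite, simple) bipartite graph with vertex classes A = Fin a and
-- B = Fin b is given by its bipartite adjacency relation  Fin a → Fin b → Bool.
BipGraph : ℕ → ℕ → Set
BipGraph a b = Fin a → Fin b → Bool

edges : ∀ {a b} → BipGraph a b → ℕ
edges {a} {b} G = sumA
  where
    sumA : ℕ
    sumA = go a G
      where
        go : ∀ m → (Fin m → Fin b → Bool) → ℕ
        go zero    H = 0
        go (suc m) H = count (H zero) + go m (λ i → H (suc i))

degA : ∀ {a b} → BipGraph a b → Fin a → ℕ
degA G v = count (G v)

codegB : ∀ {a b} → BipGraph a b → Fin b → Fin b → ℕ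
codegB G y y' = count (λ x → G x y ∧ G x y')

-- A 4-cycle in a bipartite graph alternates between the classes:
-- distinct x, x' ∈ A and distinct y, y' ∈ B with xy, xy', x'y, x'y' edges.
C4Free : ∀ {a b} → BipGraph a b → Set
C4Free {a} {b} G =
  (x x' : Fin a) (y y' : Fin b) → ¬ (x ≡ x') → ¬ (y ≡ y') →
  ¬ ((G x y ≡ true) × (G x y' ≡ true) × (G x' y ≡ true) × (G x' y' ≡ true))

record Subgraph {a b : ℕ} (G : BipGraph a b) : Set where
  field
    SA   : Fin a → Bool
    SB   : Fin b → Bool
    H    : BipGraph a b
    H⊆G  : ∀ x y → H x y ≡ true → G x y ≡ true
    H⊆SA : ∀ x y → H x y ≡ true → SA x ≡ true
    H⊆SB : ∀ x y → H x y ≡ true → SB y ≡ true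

nverts : ∀ {a b} {G : BipGraph a b} → Subgraph G → ℕ
nverts S = count (Subgraph.SA S) + count (Subgraph.SB S)

module Submission where

-- Let t = ⌊e(G)/2|A|⌋ + 1 and call x ∈ A heavy if d(x) ≥ t; vertices with fewer than t
-- neighbours carry at most half of the edges, so e(G) ≤ 2d·#heavy. Two vertices of A
-- conflict when they have two common neighbours. A maximal conflict-free set I of heavy
-- vertices, together with all edges at I, is C₄-free and has e(H) ≥ t|I| > e(G)|I|/2|A|.
-- Counting pairs of neighbours with the codegree bound shows that a vertex conflicts with
-- at most d³ others, so maximality gives #heavy ≤ (1 + d³)|I| and e(G) ≤ 2d⁶|I|. The B-side
-- of H has at most min(e(H), |B|) vertices, and |B| ≤ |A|/d⁶ ≤ |I| once e(G) ≥ 2|A|;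
-- either way e(G)·v(H) ≤ 4|A|·e(H).

open import Defs
open import Data.Bool using (Bool; true; false; if_then_else_; _∧_; not; T)
open import Data.Bool.Properties using (∧-comm; ∧-identityʳ; ¬-not) renaming (_≟_ to _≟ᵇ_)
open import Data.Fin using (Fin; zero; suc; punchIn; punchOut)
open import Data.Fin.Properties using (punchInᵢ≢i; punchIn-punchOut; any?)
open import Data.Nat
open import Data.Nat.Properties
open import Data.Nat.DivMod using (_/_; _%_; m/n*n≤m; m≡m%n+[m/n]*n; m%n<n)
open import Algebra.Properties.Semiring.Sum +-*-semiring
  using (sum; sum-syntax; ∑-distrib-+; ∑-comm; sum-cong-≗; *-distribˡ-sum; *-distribʳ-sum; sum-remove)
open import Data.Nat.Tactic.RingSolver using (solve-∀)
open import Data.Product using (Σ; _×_; _,_; proj₁; proj₂)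
open import Data.Sum using (_⊎_; inj₁; inj₂)
open import Data.Empty using (⊥-elim)
open import Data.Unit using (tt)
open import Function using (_∘_; case_of_)
open import Relation.Binary.PropositionalEquality
open import Relation.Nullary using (¬_; Dec; does; yes; no; _×-dec_; contradiction)

𝟙 : Bool → ℕ
𝟙 b = if b then 1 else 0

𝟙-∧ : ∀ p q → 𝟙 (p ∧ q) ≡ 𝟙 p * 𝟙 q
𝟙-∧ false q     = refl
𝟙-∧ true  false = refl
𝟙-∧ true  true  = refl

𝟙-idem : ∀ p → 𝟙 p * 𝟙 p ≡ 𝟙 p
𝟙-idem false = refl
𝟙-idem true  = refl

𝟙≤1 : ∀ p → 𝟙 p ≤ 1
𝟙≤1 false = z≤n
𝟙≤1 true  = ≤-refl

∑-mono-≤ : ∀ {n} {f g : Fin n → ℕ} → (∀ i → f i ≤ g i) → sum f ≤ sum g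
∑-mono-≤ {zero}  f≤g = z≤n
∑-mono-≤ {suc n} f≤g = +-mono-≤ (f≤g zero) (∑-mono-≤ (f≤g ∘ suc))

∑-const : ∀ n c → ∑[ i < n ] c ≡ n * c
∑-const zero    c = refl
∑-const (suc n) c = cong (c +_) (∑-const n c)

term≤∑ : ∀ {n} (f : Fin n → ℕ) i → f i ≤ sum f
term≤∑ f zero    = m≤m+n _ _
term≤∑ f (suc i) = ≤-trans (term≤∑ (f ∘ suc) i) (m≤n+m _ _)

∑-mono-≤-off : ∀ {n} {f g : Fin n → ℕ} j → (∀ i → i ≢ j → f i ≤ g i) → sum f ≤ f j + sum g
∑-mono-≤-off {suc n} {f} {g} j f≤g = begin
  sum f                                   ≡⟨ sum-remove f ⟩
  f j + ∑[ i < n ] f (punchIn j i)        ≤⟨ +-monoʳ-≤ (f j) (∑-mono-≤ λ i → f≤g _ (punchInᵢ≢i j i)) ⟩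
  f j + ∑[ i < n ] g (punchIn j i)        ≤⟨ +-monoʳ-≤ (f j) (m≤n+m _ (g j)) ⟩
  f j + (g j + ∑[ i < n ] g (punchIn j i)) ≡⟨ cong (f j +_) (sum-remove g) ⟨
  f j + sum g                             ∎
  where open ≤-Reasoning

∑-square : ∀ {m n} (f : Fin m → Fin n → ℕ) →
  ∑[ x < m ] (sum (f x) * sum (f x)) ≡ ∑[ y < n ] ∑[ y' < n ] ∑[ x < m ] (f x y * f x y')
∑-square {m} {n} f = begin
  ∑[ x < m ] (sum (f x) * sum (f x))             ≡⟨ sum-cong-≗ (λ x → expand (f x)) ⟩
  ∑[ x < m ] ∑[ y < n ] ∑[ y' < n ] (f x y * f x y') ≡⟨ ∑-comm (λ x y → ∑[ y' < n ] (f x y * f x y')) ⟩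
  ∑[ y < n ] ∑[ x < m ] ∑[ y' < n ] (f x y * f x y') ≡⟨ sum-cong-≗ (λ y → ∑-comm (λ x y' → f x y * f x y')) ⟩
  ∑[ y < n ] ∑[ y' < n ] ∑[ x < m ] (f x y * f x y') ∎
  where
  open ≡-Reasoning
  expand : (g : Fin n → ℕ) → sum g * sum g ≡ ∑[ y < n ] ∑[ y' < n ] (g y * g y')
  expand g = trans (*-distribʳ-sum (sum g) g) (sum-cong-≗ (λ y → *-distribˡ-sum (g y) g))

count-sum : ∀ {n} (f : Fin n → Bool) → count f ≡ ∑[ i < n ] 𝟙 (f i)
count-sum {zero}  f = refl
count-sum {suc n} f = cong (𝟙 (f zero) +_) (count-sum (f ∘ suc))

count-cong : ∀ {n} {f g : Fin n → Bool} → (∀ i → f i ≡ g i) → count f ≡ count g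
count-cong {f = f} {g} f≗g = trans (count-sum f) (trans (sum-cong-≗ (cong 𝟙 ∘ f≗g)) (sym (count-sum g)))

count≤n : ∀ {n} (f : Fin n → Bool) → count f ≤ n
count≤n {n} f = begin
  count f              ≡⟨ count-sum f ⟩
  ∑[ i < n ] 𝟙 (f i)   ≤⟨ ∑-mono-≤ (𝟙≤1 ∘ f) ⟩
  ∑[ i < n ] 1         ≡⟨ ∑-const n 1 ⟩
  n * 1                ≡⟨ *-identityʳ n ⟩
  n                    ∎
  where open ≤-Reasoning

count-sum-*ˡ : ∀ {n} k (f : Fin n → Bool) → ∑[ i < n ] (k * 𝟙 (f i)) ≡ k * count f
count-sum-*ˡ k f = trans (sym (*-distribˡ-sum k (𝟙 ∘ f))) (cong (k *_) (sym (count-sum f)))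

count-sum-*ʳ : ∀ {n} (f : Fin n → Bool) k → ∑[ i < n ] (𝟙 (f i) * k) ≡ count f * k
count-sum-*ʳ f k = trans (sym (*-distribʳ-sum k (𝟙 ∘ f))) (cong (_* k) (sym (count-sum f)))

edges-sum : ∀ {a b} (G : BipGraph a b) → edges G ≡ ∑[ x < a ] degA G x
edges-sum {zero}  G = refl
edges-sum {suc a} G = cong (degA G zero +_) (edges-sum (G ∘ suc))

edges-sumᴮ : ∀ {a b} (G : BipGraph a b) → edges G ≡ ∑[ y < b ] count (λ x → G x y)
edges-sumᴮ {a} {b} G = begin
  edges G                           ≡⟨ edges-sum G ⟩
  ∑[ x < a ] count (G x)            ≡⟨ sum-cong-≗ (λ x → count-sum (G x)) ⟩
  ∑[ x < a ] ∑[ y < b ] 𝟙 (G x y)   ≡⟨ ∑-comm (λ x y → 𝟙 (G x y)) ⟩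
  ∑[ y < b ] ∑[ x < a ] 𝟙 (G x y)   ≡⟨ sum-cong-≗ (λ y → count-sum (λ x → G x y)) ⟨
  ∑[ y < b ] count (λ x → G x y)    ∎
  where open ≡-Reasoning

count-∧ˡ : ∀ {n} p (f : Fin n → Bool) → count (λ i → p ∧ f i) ≡ 𝟙 p * count f
count-∧ˡ {n} p f = begin
  count (λ i → p ∧ f i)           ≡⟨ count-sum (λ i → p ∧ f i) ⟩
  ∑[ i < n ] 𝟙 (p ∧ f i)          ≡⟨ sum-cong-≗ (λ i → 𝟙-∧ p (f i)) ⟩
  ∑[ i < n ] (𝟙 p * 𝟙 (f i))      ≡⟨ count-sum-*ˡ (𝟙 p) f ⟩
  𝟙 p * count f                   ∎
  where open ≡-Reasoning

true⇒1≤count : ∀ {n} (f : Fin n → Bool) i → f i ≡ true → 1 ≤ count f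
true⇒1≤count f i fi≡true = begin
  1              ≡⟨ cong 𝟙 fi≡true ⟨
  𝟙 (f i)        ≤⟨ term≤∑ (𝟙 ∘ f) i ⟩
  sum (𝟙 ∘ f)    ≡⟨ count-sum f ⟨
  count f        ∎
  where open ≤-Reasoning

two-trues⇒2≤count : ∀ {n} (f : Fin n → Bool) {i j} → i ≢ j → f i ≡ true → f j ≡ true → 2 ≤ count f
two-trues⇒2≤count {suc n} f {i} {j} i≢j fi≡true fj≡true = begin
  1 + 1                                  ≡⟨ cong₂ _+_ (cong 𝟙 fi≡true) (cong 𝟙 fk≡true) ⟨
  𝟙 (f i) + 𝟙 (f (punchIn i k))          ≤⟨ +-monoʳ-≤ (𝟙 (f i)) (term≤∑ (λ l → 𝟙 (f (punchIn i l))) k) ⟩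
  𝟙 (f i) + ∑[ l < n ] 𝟙 (f (punchIn i l)) ≡⟨ sum-remove (𝟙 ∘ f) ⟨
  sum (𝟙 ∘ f)                            ≡⟨ count-sum f ⟨
  count f                                ∎
  where
  open ≤-Reasoning
  k : Fin n
  k = punchOut i≢j
  fk≡true : f (punchIn i k) ≡ true
  fk≡true = trans (cong f (punchIn-punchOut i≢j)) fj≡true

∧-true⁻ : ∀ p {q} → (p ∧ q) ≡ true → p ≡ true × q ≡ true
∧-true⁻ true q≡true = refl , q≡true

∧-true⁺ : ∀ {p q} → p ≡ true → q ≡ true → (p ∧ q) ≡ true
∧-true⁺ refl q≡true = q≡true

≤ᵇ-true⇒≤ : ∀ {m n} → (m ≤ᵇ n) ≡ true → m ≤ n
≤ᵇ-true⇒≤ {m} {n} m≤ᵇn = ≤ᵇ⇒≤ m n (subst T (sym m≤ᵇn) tt)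

≤⇒≤ᵇ-true : ∀ {m n} → m ≤ n → (m ≤ᵇ n) ≡ true
≤⇒≤ᵇ-true {m} {n} m≤n with m ≤ᵇ n | ≤⇒≤ᵇ m≤n
... | true | _ = refl

≤ᵇ-false⇒> : ∀ {m n} → (m ≤ᵇ n) ≡ false → n < m
≤ᵇ-false⇒> m≰ᵇn = ≰⇒> λ m≤n → subst T m≰ᵇn (≤⇒≤ᵇ m≤n)

2*𝟙[2≤n]+n≤n*n : ∀ n → 2 * 𝟙 (2 ≤ᵇ n) + n ≤ n * n
2*𝟙[2≤n]+n≤n*n zero                = z≤n
2*𝟙[2≤n]+n≤n*n (suc zero)          = ≤-refl
2*𝟙[2≤n]+n≤n*n n@(suc (suc n-2))   = begin
  2 + n        ≡⟨ +-comm 2 n ⟩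
  n + 2        ≤⟨ +-monoʳ-≤ n (≤-trans (s≤s (s≤s z≤n)) (m≤m+n n (n-2 * n))) ⟩
  n * n        ∎
  where open ≤-Reasoning

codegree-restricted : ∀ {a b} (G : BipGraph a b) (r : Fin b → Bool) y y' →
  ∑[ x < a ] (𝟙 (G x y ∧ r y) * 𝟙 (G x y' ∧ r y')) ≡ 𝟙 (r y') * (𝟙 (r y) * codegB G y y')
codegree-restricted {a} G r y y' = begin
  ∑[ x < a ] (𝟙 (G x y ∧ r y) * 𝟙 (G x y' ∧ r y'))       ≡⟨ sum-cong-≗ factor ⟩
  ∑[ x < a ] (𝟙 (r y') * 𝟙 (r y) * 𝟙 (G x y ∧ G x y'))   ≡⟨ count-sum-*ˡ (𝟙 (r y') * 𝟙 (r y)) (λ x → G x y ∧ G x y') ⟩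
  𝟙 (r y') * 𝟙 (r y) * codegB G y y'                    ≡⟨ *-assoc (𝟙 (r y')) _ _ ⟩
  𝟙 (r y') * (𝟙 (r y) * codegB G y y')                  ∎
  where
  open ≡-Reasoning
  regroup : ∀ p q s t → p * q * (s * t) ≡ t * q * (p * s)
  regroup = solve-∀
  factor : ∀ x → 𝟙 (G x y ∧ r y) * 𝟙 (G x y' ∧ r y') ≡ 𝟙 (r y') * 𝟙 (r y) * 𝟙 (G x y ∧ G x y')
  factor x = begin
    𝟙 (G x y ∧ r y) * 𝟙 (G x y' ∧ r y')              ≡⟨ cong₂ _*_ (𝟙-∧ (G x y) (r y)) (𝟙-∧ (G x y') (r y')) ⟩
    𝟙 (G x y) * 𝟙 (r y) * (𝟙 (G x y') * 𝟙 (r y'))      ≡⟨ regroup (𝟙 (G x y)) (𝟙 (r y)) (𝟙 (G x y')) (𝟙 (r y')) ⟩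
    𝟙 (r y') * 𝟙 (r y) * (𝟙 (G x y) * 𝟙 (G x y'))      ≡⟨ cong (𝟙 (r y') * 𝟙 (r y) *_) (𝟙-∧ (G x y) (G x y')) ⟨
    𝟙 (r y') * 𝟙 (r y) * 𝟙 (G x y ∧ G x y')           ∎

-- Counting pairs (y, y') of neighbours of x inside r: ∑ₓ cₓ² ≤ ∑ₓ cₓ + |r|²d by the
-- codegree bound off the diagonal, while cₓ² ≥ cₓ + 2 whenever cₓ ≥ 2.
cherry-bound : ∀ {a b} d (G : BipGraph a b) (r : Fin b → Bool) →
  (∀ y y' → y ≢ y' → codegB G y y' ≤ d) →
  2 * count (λ x → 2 ≤ᵇ count (λ y → G x y ∧ r y)) ≤ count r * (count r * d)
cherry-bound {a} {b} d G r codeg≤d = +-cancelʳ-≤ (sum c) _ _ (begin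
  2 * count many + sum c                 ≡⟨ cong (λ k → 2 * k + sum c) (count-sum many) ⟩
  2 * ∑[ x < a ] 𝟙 (many x) + sum c      ≡⟨ cong (_+ sum c) (*-distribˡ-sum 2 (𝟙 ∘ many)) ⟩
  ∑[ x < a ] (2 * 𝟙 (many x)) + sum c    ≡⟨ ∑-distrib-+ (λ x → 2 * 𝟙 (many x)) c ⟨
  ∑[ x < a ] (2 * 𝟙 (many x) + c x)      ≤⟨ ∑-mono-≤ (λ x → 2*𝟙[2≤n]+n≤n*n (c x)) ⟩
  ∑[ x < a ] (c x * c x)                 ≡⟨ sum-cong-≗ (λ x → cong₂ _*_ (count-sum (N x)) (count-sum (N x))) ⟩
  ∑[ x < a ] (sum (f x) * sum (f x))     ≡⟨ ∑-square f ⟩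
  ∑[ y < b ] ∑[ y' < b ] P y y'          ≤⟨ ∑-mono-≤ (λ y → ∑-mono-≤-off y (off-diagonal y)) ⟩
  ∑[ y < b ] (P y y + ∑[ y' < b ] (𝟙 (r y') * (𝟙 (r y) * d)))
      ≡⟨ ∑-distrib-+ (λ y → P y y) _ ⟩
  ∑[ y < b ] P y y + ∑[ y < b ] ∑[ y' < b ] (𝟙 (r y') * (𝟙 (r y) * d))
      ≡⟨ cong₂ _+_ diagonal (sum-cong-≗ λ y → count-sum-*ʳ r (𝟙 (r y) * d)) ⟩
  sum c + ∑[ y < b ] (count r * (𝟙 (r y) * d))  ≡⟨ cong (sum c +_) (*-distribˡ-sum (count r) (λ y → 𝟙 (r y) * d)) ⟨
  sum c + count r * ∑[ y < b ] (𝟙 (r y) * d)    ≡⟨ cong (λ k → sum c + count r * k) (count-sum-*ʳ r d) ⟩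
  sum c + count r * (count r * d)        ≡⟨ +-comm (sum c) _ ⟩
  count r * (count r * d) + sum c        ∎)
  where
  open ≤-Reasoning
  N : Fin a → Fin b → Bool
  N x y = G x y ∧ r y
  f : Fin a → Fin b → ℕ
  f x y = 𝟙 (N x y)
  c : Fin a → ℕ
  c x = count (N x)
  many : Fin a → Bool
  many x = 2 ≤ᵇ c x
  P : Fin b → Fin b → ℕ
  P y y' = ∑[ x < a ] (f x y * f x y')

  off-diagonal : ∀ y y' → y' ≢ y → P y y' ≤ 𝟙 (r y') * (𝟙 (r y) * d)
  off-diagonal y y' y'≢y rewrite codegree-restricted G r y y' =
    *-monoʳ-≤ (𝟙 (r y')) (*-monoʳ-≤ (𝟙 (r y)) (codeg≤d y y' (y'≢y ∘ sym)))

  diagonal : ∑[ y < b ] P y y ≡ sum c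
  diagonal = begin-equality
    ∑[ y < b ] ∑[ x < a ] (f x y * f x y) ≡⟨ sum-cong-≗ (λ y → sum-cong-≗ λ x → 𝟙-idem (G x y ∧ r y)) ⟩
    ∑[ y < b ] ∑[ x < a ] f x y           ≡⟨ ∑-comm f ⟨
    ∑[ x < a ] sum (f x)                  ≡⟨ sum-cong-≗ (λ x → count-sum (N x)) ⟨
    sum c                                 ∎

restrict : ∀ {m} → (Fin (suc m) → Fin (suc m) → Bool) → Fin m → Fin m → Bool
restrict R x y = R (suc x) (suc y)

mutual
  greedy : ∀ {m} → (Fin m → Bool) → (Fin m → Fin m → Bool) → Fin m → Bool
  greedy {suc m} P R zero    = P zero ∧ not (does (blockedByLater P R))
  greedy {suc m} P R (suc i) = greedy (P ∘ suc) (restrict R) i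

  blockedByLater : ∀ {m} (P : Fin (suc m) → Bool) R →
    Dec (Σ (Fin m) λ i → greedy (P ∘ suc) (restrict R) i ≡ true × R zero (suc i) ≡ true)
  blockedByLater P R = any? λ i → greedy (P ∘ suc) (restrict R) i ≟ᵇ true ×-dec R zero (suc i) ≟ᵇ true

greedy-zero⁻ : ∀ {m} P R → greedy {suc m} P R zero ≡ true →
  P zero ≡ true × ¬ (Σ (Fin m) λ i → greedy (P ∘ suc) (restrict R) i ≡ true × R zero (suc i) ≡ true)
greedy-zero⁻ P R g with P zero | blockedByLater P R
... | true | no ¬blocked = refl , ¬blocked

greedy-zero⁺ : ∀ {m} P R → P zero ≡ true →
  ¬ (Σ (Fin m) λ i → greedy (P ∘ suc) (restrict R) i ≡ true × R zero (suc i) ≡ true) →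
  greedy {suc m} P R zero ≡ true
greedy-zero⁺ P R P0 ¬blocked with blockedByLater P R
... | yes blocked = ⊥-elim (¬blocked blocked)
... | no _        = trans (∧-identityʳ (P zero)) P0

greedy-⊆ : ∀ {m} P R (x : Fin m) → greedy P R x ≡ true → P x ≡ true
greedy-⊆ {suc m} P R zero    g = proj₁ (greedy-zero⁻ P R g)
greedy-⊆ {suc m} P R (suc i) g = greedy-⊆ (P ∘ suc) (restrict R) i g

greedy-independent : ∀ {m} P R → (∀ x y → R x y ≡ R y x) →
  ∀ {x x' : Fin m} → x ≢ x' → greedy P R x ≡ true → greedy P R x' ≡ true → R x x' ≡ false
greedy-independent P R R-sym {zero}  {zero}   0≢0 _ _ = ⊥-elim (0≢0 refl)
greedy-independent P R R-sym {zero}  {suc j} _ g g' =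
  ¬-not λ R0j → proj₂ (greedy-zero⁻ P R g) (j , g' , R0j)
greedy-independent P R R-sym {suc i} {zero}  _ g g' =
  trans (R-sym (suc i) zero) (greedy-independent P R R-sym (λ ()) g' g)
greedy-independent P R R-sym {suc i} {suc j} i≢j g g' =
  greedy-independent (P ∘ suc) (restrict R) (λ x y → R-sym (suc x) (suc y)) (i≢j ∘ cong suc) g g'

greedy-maximal : ∀ {m} P R (x : Fin m) → P x ≡ true →
  greedy P R x ≡ true ⊎ Σ (Fin m) λ x' → greedy P R x' ≡ true × R x x' ≡ true
greedy-maximal {suc m} P R zero P0 = case blockedByLater P R of λ where
  (yes (i , g , R0i)) → inj₂ (suc i , g , R0i)
  (no ¬blocked)       → inj₁ (greedy-zero⁺ P R P0 ¬blocked)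
greedy-maximal {suc m} P R (suc i) Pi with greedy-maximal (P ∘ suc) (restrict R) i Pi
... | inj₁ g              = inj₁ g
... | inj₂ (j , g , Rij)  = inj₂ (suc j , g , Rij)

dominated-count : ∀ {m} (P I : Fin m → Bool) (R : Fin m → Fin m → Bool) K →
  (∀ x → P x ≡ true → I x ≡ true ⊎ Σ (Fin m) λ x' → I x' ≡ true × R x x' ≡ true) →
  (∀ x' → count (λ x → R x x') ≤ K) →
  count P ≤ count I + count I * K
dominated-count {m} P I R K dominated R-deg≤K = begin
  count P                                              ≡⟨ count-sum P ⟩
  ∑[ x < m ] 𝟙 (P x)                                   ≤⟨ ∑-mono-≤ covered ⟩
  ∑[ x < m ] (𝟙 (I x) + ∑[ x' < m ] (𝟙 (I x') * 𝟙 (R x x')))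
      ≡⟨ ∑-distrib-+ (𝟙 ∘ I) _ ⟩
  ∑[ x < m ] 𝟙 (I x) + ∑[ x < m ] ∑[ x' < m ] (𝟙 (I x') * 𝟙 (R x x'))
      ≡⟨ cong₂ _+_ (sym (count-sum I)) (∑-comm (λ x x' → 𝟙 (I x') * 𝟙 (R x x'))) ⟩
  count I + ∑[ x' < m ] ∑[ x < m ] (𝟙 (I x') * 𝟙 (R x x'))
      ≡⟨ cong (count I +_) (sum-cong-≗ λ x' → count-sum-*ˡ (𝟙 (I x')) (λ x → R x x')) ⟩
  count I + ∑[ x' < m ] (𝟙 (I x') * count (λ x → R x x'))
      ≤⟨ +-monoʳ-≤ (count I) (∑-mono-≤ λ x' → *-monoʳ-≤ (𝟙 (I x')) (R-deg≤K x')) ⟩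
  count I + ∑[ x' < m ] (𝟙 (I x') * K)                 ≡⟨ cong (count I +_) (count-sum-*ʳ I K) ⟩
  count I + count I * K                                ∎
  where
  open ≤-Reasoning
  covered : ∀ x → 𝟙 (P x) ≤ 𝟙 (I x) + ∑[ x' < m ] (𝟙 (I x') * 𝟙 (R x x'))
  covered x with P x in Px
  ... | false = z≤n
  ... | true with dominated x Px
  ...   | inj₁ Ix = ≤-trans (≤-reflexive (cong 𝟙 (sym Ix))) (m≤m+n _ _)
  ...   | inj₂ (x' , Ix' , Rxx') = ≤-trans (≤-reflexive (cong₂ (λ p q → 𝟙 p * 𝟙 q) (sym Ix') (sym Rxx')))
                                     (≤-trans (term≤∑ (λ x' → 𝟙 (I x') * 𝟙 (R x x')) x') (m≤n+m _ _))

conflict : ∀ {a b} → BipGraph a b → Fin a → Fin a → Bool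
conflict G x x' = 2 ≤ᵇ count (λ y → G x y ∧ G x' y)

conflict-sym : ∀ {a b} (G : BipGraph a b) x x' → conflict G x x' ≡ conflict G x' x
conflict-sym G x x' = cong (2 ≤ᵇ_) (count-cong (λ y → ∧-comm (G x y) (G x' y)))

conflict-degree : ∀ {a b} d (G : BipGraph a b) →
  (∀ y y' → y ≢ y' → codegB G y y' ≤ d) → (∀ x → degA G x ≤ d) →
  ∀ x' → count (λ x → conflict G x x') ≤ d * (d * d)
conflict-degree d G codeg≤d deg≤d x' = begin
  count (λ x → conflict G x x')       ≤⟨ m≤m+n _ _ ⟩
  2 * count (λ x → conflict G x x')   ≤⟨ cherry-bound d G (G x') codeg≤d ⟩
  degA G x' * (degA G x' * d)         ≤⟨ *-mono-≤ (deg≤d x') (*-monoˡ-≤ d (deg≤d x')) ⟩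
  d * (d * d)                         ∎
  where open ≤-Reasoning

m≤n+k∧2k≤m⇒m≤2n : ∀ {m n k} → 2 * k ≤ m → m ≤ n + k → m ≤ 2 * n
m≤n+k∧2k≤m⇒m≤2n {m} {n} {k} 2k≤m m≤n+k = +-cancelʳ-≤ m m (2 * n) (begin
  m + m            ≡⟨ cong (m +_) (+-identityʳ m) ⟨
  2 * m            ≤⟨ *-monoʳ-≤ 2 m≤n+k ⟩
  2 * (n + k)      ≡⟨ *-distribˡ-+ 2 n k ⟩
  2 * n + 2 * k    ≤⟨ +-monoʳ-≤ (2 * n) 2k≤m ⟩
  2 * n + m        ∎)
  where open ≤-Reasoning

h≤s[1+d³]⇒h*d≤s*d⁶ : ∀ {d h s} → 2 ≤ d → h ≤ s + s * (d * (d * d)) → h * d ≤ s * d ^ 6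
h≤s[1+d³]⇒h*d≤s*d⁶ {d} {h} {s} 2≤d h≤s[1+d³] = begin
  h * d                        ≤⟨ *-monoˡ-≤ d h≤s[1+d³] ⟩
  (s + s * (d * (d * d))) * d  ≡⟨ expand s d ⟩
  s * (d ^ 1 + d ^ 4)          ≤⟨ *-monoʳ-≤ s d+d⁴≤d⁶ ⟩
  s * d ^ 6                    ∎
  where
  open ≤-Reasoning
  instance d≢0 : NonZero d
  d≢0 = >-nonZero (≤-trans (s≤s z≤n) 2≤d)
  expand : ∀ s d → (s + s * (d * (d * d))) * d ≡ s * (d * 1 + d * (d * (d * (d * 1))))
  expand = solve-∀
  d+d⁴≤d⁶ : d ^ 1 + d ^ 4 ≤ d ^ 6
  d+d⁴≤d⁶ = begin
    d ^ 1 + d ^ 4   ≤⟨ +-monoˡ-≤ (d ^ 4) (^-monoʳ-≤ d {1} {4} (s≤s z≤n)) ⟩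
    d ^ 4 + d ^ 4   ≡⟨ cong (d ^ 4 +_) (+-identityʳ (d ^ 4)) ⟨
    2 * d ^ 4       ≤⟨ *-monoˡ-≤ (d ^ 4) 2≤d ⟩
    d ^ 5           ≤⟨ m≤n*m (d ^ 5) d ⟩
    d ^ 6           ∎

density-bound : ∀ {a b e q s sb eH D} .{{_ : NonZero D}} →
  D * b ≤ a → e < suc q * (2 * a) → e ≤ 2 * (s * D) →
  suc q * s ≤ eH → sb ≤ eH → sb ≤ b →
  e * (s + sb) ≤ 5 * eH * (a + b)
density-bound {a} {b} {e} {q} {s} {sb} {eH} {D} Db≤a e<[1+q]u e≤2sD [1+q]s≤eH sb≤eH sb≤b = begin
  e * (s + sb)          ≡⟨ *-distribˡ-+ e s sb ⟩
  e * s + e * sb        ≤⟨ +-mono-≤ es≤ueH esb≤ueH ⟩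
  u * eH + u * eH       ≤⟨ m≤m+n _ _ ⟩
  u * eH + u * eH + (a * eH + 5 * eH * b) ≡⟨ regroup a b eH ⟨
  5 * eH * (a + b)      ∎
  where
  open ≤-Reasoning
  u : ℕ
  u = 2 * a
  regroup : ∀ a b eH → 5 * eH * (a + b) ≡ 2 * a * eH + 2 * a * eH + (a * eH + 5 * eH * b)
  regroup = solve-∀

  es≤ueH : e * s ≤ u * eH
  es≤ueH = begin
    e * s               ≤⟨ *-monoˡ-≤ s (<⇒≤ e<[1+q]u) ⟩
    suc q * u * s       ≡⟨ cong (_* s) (*-comm (suc q) u) ⟩
    u * suc q * s       ≡⟨ *-assoc u (suc q) s ⟩
    u * (suc q * s)     ≤⟨ *-monoʳ-≤ u [1+q]s≤eH ⟩
    u * eH              ∎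

  b≤s : u ≤ e → b ≤ s
  b≤s u≤e = *-cancelʳ-≤ b s D (*-cancelˡ-≤ 2 (begin
    2 * (b * D)         ≡⟨ cong (2 *_) (*-comm b D) ⟩
    2 * (D * b)         ≤⟨ *-monoʳ-≤ 2 Db≤a ⟩
    u                   ≤⟨ u≤e ⟩
    e                   ≤⟨ e≤2sD ⟩
    2 * (s * D)         ∎))

  esb≤ueH : e * sb ≤ u * eH
  esb≤ueH with u ≤? e
  ... | yes u≤e = ≤-trans (*-monoʳ-≤ e (≤-trans sb≤b (b≤s u≤e))) es≤ueH
  ... | no  u≰e = *-mono-≤ (<⇒≤ (≰⇒> u≰e)) sb≤eH

m<[1+m/n]*n : ∀ m n .{{_ : NonZero n}} → m < suc (m / n) * n
m<[1+m/n]*n m n = begin-strict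
  m                    ≡⟨ m≡m%n+[m/n]*n m n ⟩
  m % n + m / n * n    <⟨ +-monoˡ-< (m / n * n) (m%n<n m n) ⟩
  n + m / n * n        ∎
  where open ≤-Reasoning

positive-factor : ∀ {m n k} → 1 ≤ m → m ≤ 2 * (n * k) → 1 ≤ n
positive-factor {n = zero}  1≤m m≤0 = contradiction (≤-trans 1≤m m≤0) λ ()
positive-factor {n = suc _} _   _   = s≤s z≤n

module GreedySubgraph {a b} (G : BipGraph a b) (t : ℕ) where

  heavy : Fin a → Bool
  heavy x = t ≤ᵇ degA G x

  chosen : Fin a → Bool
  chosen = greedy heavy (conflict G)

  H : BipGraph a b
  H x y = chosen x ∧ G x y

  H⇒chosen : ∀ x y → H x y ≡ true → chosen x ≡ true
  H⇒chosen x y = proj₁ ∘ ∧-true⁻ (chosen x)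

  H⇒G : ∀ x y → H x y ≡ true → G x y ≡ true
  H⇒G x y = proj₂ ∘ ∧-true⁻ (chosen x)

  touched : Fin b → Bool
  touched y = 1 ≤ᵇ count (λ x → H x y)

  subgraph : Subgraph G
  subgraph = record
    { SA   = chosen
    ; SB   = touched
    ; H    = H
    ; H⊆G  = H⇒G
    ; H⊆SA = H⇒chosen
    ; H⊆SB = λ x y Hxy → ≤⇒≤ᵇ-true (true⇒1≤count (λ x' → H x' y) x Hxy)
    }

  H-C4Free : C4Free H
  H-C4Free x x' y y' x≢x' y≢y' (Hxy , Hxy' , Hx'y , Hx'y') = case
    trans (sym (≤⇒≤ᵇ-true two-common)) no-conflict
    of λ ()
    where
    no-conflict : conflict G x x' ≡ false
    no-conflict = greedy-independent heavy (conflict G) (conflict-sym G) x≢x'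
      (H⇒chosen x y Hxy) (H⇒chosen x' y Hx'y)
    two-common : 2 ≤ count (λ z → G x z ∧ G x' z)
    two-common = two-trues⇒2≤count (λ z → G x z ∧ G x' z) y≢y'
      (∧-true⁺ (H⇒G x y Hxy) (H⇒G x' y Hx'y)) (∧-true⁺ (H⇒G x y' Hxy') (H⇒G x' y' Hx'y'))

  threshold*chosen≤edges : t * count chosen ≤ edges H
  threshold*chosen≤edges = begin
    t * count chosen                           ≡⟨ *-comm t (count chosen) ⟩
    count chosen * t                           ≡⟨ count-sum-*ʳ chosen t ⟨
    ∑[ x < a ] (𝟙 (chosen x) * t)              ≤⟨ ∑-mono-≤ (λ x → heavy-if-chosen x) ⟩
    ∑[ x < a ] (𝟙 (chosen x) * degA G x)       ≡⟨ sum-cong-≗ (λ x → count-∧ˡ (chosen x) (G x)) ⟨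
    ∑[ x < a ] count (H x)                     ≡⟨ edges-sum H ⟨
    edges H                                    ∎
    where
    open ≤-Reasoning
    heavy-if-chosen : ∀ x → 𝟙 (chosen x) * t ≤ 𝟙 (chosen x) * degA G x
    heavy-if-chosen x with chosen x in chosen-x
    ... | false = z≤n
    ... | true  = *-monoʳ-≤ 1 (≤ᵇ-true⇒≤ (greedy-⊆ heavy (conflict G) x chosen-x))

  touched≤edges : count touched ≤ edges H
  touched≤edges = begin
    count touched                        ≡⟨ count-sum touched ⟩
    ∑[ y < b ] 𝟙 (touched y)             ≤⟨ ∑-mono-≤ (λ y → 𝟙[1≤n]≤n (count (λ x → H x y))) ⟩
    ∑[ y < b ] count (λ x → H x y)       ≡⟨ edges-sumᴮ H ⟨
    edges H                              ∎
    where
    open ≤-Reasoning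
    𝟙[1≤n]≤n : ∀ n → 𝟙 (1 ≤ᵇ n) ≤ n
    𝟙[1≤n]≤n zero    = z≤n
    𝟙[1≤n]≤n (suc n) = s≤s z≤n

  edges≤heavy+light : ∀ d → (∀ x → degA G x ≤ d) → edges G ≤ count heavy * d + a * pred t
  edges≤heavy+light d deg≤d = begin
    edges G                                            ≡⟨ edges-sum G ⟩
    ∑[ x < a ] degA G x                                ≤⟨ ∑-mono-≤ degree-bound ⟩
    ∑[ x < a ] (𝟙 (heavy x) * d + pred t)             ≡⟨ ∑-distrib-+ (λ x → 𝟙 (heavy x) * d) (λ _ → pred t) ⟩
    ∑[ x < a ] (𝟙 (heavy x) * d) + ∑[ x < a ] pred t  ≡⟨ cong₂ _+_ (count-sum-*ʳ heavy d) (∑-const a (pred t)) ⟩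
    count heavy * d + a * pred t                      ∎
    where
    open ≤-Reasoning
    degree-bound : ∀ x → degA G x ≤ 𝟙 (heavy x) * d + pred t
    degree-bound x with heavy x in heavy-x
    ... | true  = m≤n⇒m≤n+o (pred t) (≤-trans (deg≤d x) (≤-reflexive (sym (*-identityˡ d))))
    ... | false = <⇒≤pred (≤ᵇ-false⇒> {t} heavy-x)

  heavy≤chosen : ∀ d → (∀ y y' → y ≢ y' → codegB G y y' ≤ d) → (∀ x → degA G x ≤ d) →
    count heavy ≤ count chosen + count chosen * (d * (d * d))
  heavy≤chosen d codeg≤d deg≤d = dominated-count heavy chosen (conflict G) (d * (d * d))
    (greedy-maximal heavy (conflict G)) (conflict-degree d G codeg≤d deg≤d)

  edges≤chosen*d⁶ : ∀ d → 2 ≤ d → (∀ y y' → y ≢ y' → codegB G y y' ≤ d) → (∀ x → degA G x ≤ d) →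
    pred t * (2 * a) ≤ edges G → edges G ≤ 2 * (count chosen * d ^ 6)
  edges≤chosen*d⁶ d 2≤d codeg≤d deg≤d light≤half = begin
    edges G                       ≤⟨ m≤n+k∧2k≤m⇒m≤2n {n = count heavy * d}
                                       (≤-trans (≤-reflexive (regroup a (pred t))) light≤half)
                                       (edges≤heavy+light d deg≤d) ⟩
    2 * (count heavy * d)         ≤⟨ *-monoʳ-≤ 2 (h≤s[1+d³]⇒h*d≤s*d⁶ {s = count chosen} 2≤d
                                                    (heavy≤chosen d codeg≤d deg≤d)) ⟩
    2 * (count chosen * d ^ 6)    ∎
    where
    open ≤-Reasoning
    regroup : ∀ a q → 2 * (a * q) ≡ q * (2 * a)
    regroup = solve-∀

DenseC4FreeSubgraph : ∀ {a b} → BipGraph a b → Set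
DenseC4FreeSubgraph {a} {b} G = Σ (Subgraph G) λ G' →
  C4Free (Subgraph.H G') × 1 ≤ nverts G' × edges G * nverts G' ≤ 5 * edges (Subgraph.H G') * (a + b)

edgeless-spanning : ∀ {a b} (G : BipGraph a b) → edges G ≡ 0 → 1 ≤ a + b → DenseC4FreeSubgraph G
edgeless-spanning {a} {b} G e≡0 1≤a+b = spanning , (λ { _ _ _ _ _ _ (() , _) }) , 1≤n , e*n≤0
  where
  spanning : Subgraph G
  spanning = record
    { SA = λ _ → true ; SB = λ _ → true ; H = λ _ _ → false
    ; H⊆G = λ _ _ () ; H⊆SA = λ _ _ () ; H⊆SB = λ _ _ () }
  count-all : ∀ n → count {n} (λ _ → true) ≡ n
  count-all n = trans (count-sum {n} (λ _ → true)) (trans (∑-const n 1) (*-identityʳ n))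
  1≤n : 1 ≤ nverts spanning
  1≤n = subst (1 ≤_) (sym (cong₂ _+_ (count-all a) (count-all b))) 1≤a+b
  e*n≤0 : edges G * nverts spanning ≤ 5 * edges (Subgraph.H spanning) * (a + b)
  e*n≤0 rewrite e≡0 = z≤n

lemma3p5 : (d a b : ℕ) → 2 ≤ d → 1 ≤ a + b → (G : BipGraph a b) →
    d ^ 6 * b ≤ a →
    ((y y' : Fin b) → ¬ (y ≡ y') → codegB G y y' ≤ d) →
    ((v : Fin a) → degA G v ≤ d) →
    Σ (Subgraph G) (λ G' → C4Free (Subgraph.H G') × 1 ≤ nverts G' ×
      edges G * nverts G' ≤ 5 * edges (Subgraph.H G') * (a + b))
lemma3p5 d zero    b _ 1≤a+b G _ _ _ = edgeless-spanning G refl 1≤a+b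
lemma3p5 d (suc a) b 2≤d 1≤a+b G D*b≤a codeg≤d deg≤d with 1 ≤? edges G
... | no  e≱1 = edgeless-spanning G (n<1⇒n≡0 (≰⇒> e≱1)) 1≤a+b
... | yes e≥1 = subgraph , H-C4Free , positive , density-bound {q = q} {{d⁶≢0}} D*b≤a e<[1+q]u e≤2sd⁶
                  threshold*chosen≤edges touched≤edges (count≤n touched)
  where
  u : ℕ
  u = 2 * suc a
  q : ℕ
  q = edges G / u
  open GreedySubgraph G (suc q)
  d⁶≢0 : NonZero (d ^ 6)
  d⁶≢0 = m^n≢0 d 6 {{>-nonZero (≤-trans (s≤s z≤n) 2≤d)}}
  e<[1+q]u : edges G < suc q * u
  e<[1+q]u = m<[1+m/n]*n (edges G) u
  e≤2sd⁶ : edges G ≤ 2 * (count chosen * d ^ 6)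
  e≤2sd⁶ = edges≤chosen*d⁶ d 2≤d codeg≤d deg≤d (m/n*n≤m (edges G) u)
  positive : 1 ≤ count chosen + count touched
  positive = ≤-trans (positive-factor {n = count chosen} e≥1 e≤2sd⁶) (m≤m+n _ _)
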